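{- Let $(P,\le,{}',0,1)$ be a bounded poset with a complementation $'$ which is strongly modular, and put \[ M(x,y):=L(U(x,y'),y),\qquad R(x,y):=LU(L(x,y),x') \] for all $x,y\in P$. Then $(P,\le,{}',M,R,0,1)$ is a divisible operator left residuated poset.
   Context: For a poset $(P,\le)$ and $A\subseteq P$, $L(A)=\{x\in P\mid x\le y \text{ for all } y\in A\}$ and $U(A)=\{x\in P\mid x\ge y\text{ for all }y\in A\}$; one writes $L(a,b)$ for $L(\{a,b\})$, $L(a,A)$ for $L(\{a\}\cup A)$, $L(A,B)$ for $L(A\cup B)$, $LU(A)$ for $L(U(A))$, and similarly for other combinations. A unary operation $'$ on a bounded poset $(P,\le,0,1)$ is a complementation if $U(x,x')=\{1\}$ and $L(x,x')=\{0\}$ for all $x\in P$ (it need not be antitone or an involution). A poset is strongly modular if for all $x,y,z\in P$: $L(U(x,y),U(x,z))=LU(x,L(y,U(x,z)))$ and $L(U(L(x,z),y),z)=LU(L(x,z),L(y,z))$. An operator left residuated poset is a tuple $(P,\le,{}',M,R,0,1)$ where $(P,\le,{}',0,1)$ is a bounded poset with a unary operation and $M,R:P^2\to 2^P$ satisfy for all $x,y,z\in P$: (i) $M(x,1)=M(1,x)=L(x)$; (ii) $M(x,y)\subseteq L(z)$ if and only if $L(x)\subseteq R(y,z)$; (iii) $R(x,0)=L(x')$. It is divisible if $M(R(x,y),x)=L(x,y)$ for all $x,y\in P$, where $M$ applied to a set in the first argument is understood via the defining formula, i.e. $M(A,y)=L(U(A,y'),y)$. -}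

module Defs where

open import Level using (Level; _⊔_)
open import Data.Product using (_×_)
open import Relation.Unary using (Pred; _⊆_; _≐_; _∪_)
open import Relation.Binary.Bundles using (Poset)

module PosetNotions {c ℓ₁ ℓ₂ : Level} (P : Poset c ℓ₁ ℓ₂) where
  open Poset P

  ⟦_⟧ : Carrier → Pred Carrier ℓ₁
  ⟦ a ⟧ = λ z → z ≈ a

  ⟦_,_⟧ : Carrier → Carrier → Pred Carrier ℓ₁
  ⟦ a , b ⟧ = ⟦ a ⟧ ∪ ⟦ b ⟧

  L : {ℓ : Level} → Pred Carrier ℓ → Pred Carrier (c ⊔ ℓ ⊔ ℓ₂)
  L A x = ∀ y → A y → x ≤ y

  U : {ℓ : Level} → Pred Carrier ℓ → Pred Carrier (c ⊔ ℓ ⊔ ℓ₂)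
  U A x = ∀ y → A y → y ≤ x

  IsBounded : Carrier → Carrier → Set (c ⊔ ℓ₂)
  IsBounded 0# 1# = (∀ x → 0# ≤ x) × (∀ x → x ≤ 1#)

  IsComplementation : Carrier → Carrier → (Carrier → Carrier) → Set (c ⊔ ℓ₁ ⊔ ℓ₂)
  IsComplementation 0# 1# _′ =
    ∀ x → (U ⟦ x , x ′ ⟧ ≐ ⟦ 1# ⟧) × (L ⟦ x , x ′ ⟧ ≐ ⟦ 0# ⟧)

  IsStronglyModular : Set (c ⊔ ℓ₁ ⊔ ℓ₂)
  IsStronglyModular =
    (∀ x y z → L (U ⟦ x , y ⟧ ∪ U ⟦ x , z ⟧)
                ≐ L (U (⟦ x ⟧ ∪ L (⟦ y ⟧ ∪ U ⟦ x , z ⟧))))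
    × (∀ x y z → L (U (L ⟦ x , z ⟧ ∪ ⟦ y ⟧) ∪ ⟦ z ⟧)
                ≐ L (U (L ⟦ x , z ⟧ ∪ L ⟦ y , z ⟧)))

  IsOperatorLeftResiduated : Carrier → Carrier → (Carrier → Carrier)
    → (Carrier → Carrier → Pred Carrier (c ⊔ ℓ₁ ⊔ ℓ₂))
    → (Carrier → Carrier → Pred Carrier (c ⊔ ℓ₁ ⊔ ℓ₂))
    → Set (c ⊔ ℓ₁ ⊔ ℓ₂)
  IsOperatorLeftResiduated 0# 1# _′ M R =
    IsBounded 0# 1#
    × (∀ x → (M x 1# ≐ L ⟦ x ⟧) × (M 1# x ≐ L ⟦ x ⟧))
    × (∀ x y z → ((M x y ⊆ L ⟦ z ⟧) → (L ⟦ x ⟧ ⊆ R y z))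
               × ((L ⟦ x ⟧ ⊆ R y z) → (M x y ⊆ L ⟦ z ⟧)))
    × (∀ x → R x 0# ≐ L ⟦ x ′ ⟧)

  MSet : (Carrier → Carrier) → Pred Carrier (c ⊔ ℓ₁ ⊔ ℓ₂) → Carrier
    → Pred Carrier (c ⊔ ℓ₁ ⊔ ℓ₂)
  MSet _′ A y = L (U (A ∪ ⟦ y ′ ⟧) ∪ ⟦ y ⟧)

  IsDivisible : (Carrier → Carrier)
    → (Carrier → Carrier → Pred Carrier (c ⊔ ℓ₁ ⊔ ℓ₂)) → Set (c ⊔ ℓ₁ ⊔ ℓ₂)
  IsDivisible _′ R = ∀ x y → MSet _′ (R x y) x ≐ L ⟦ x , y ⟧

  Mop : (Carrier → Carrier) → Carrier → Carrier → Pred Carrier (c ⊔ ℓ₁ ⊔ ℓ₂)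
  Mop _′ x y = L (U ⟦ x , y ′ ⟧ ∪ ⟦ y ⟧)

  Rop : (Carrier → Carrier) → Carrier → Carrier → Pred Carrier (c ⊔ ℓ₁ ⊔ ℓ₂)
  Rop _′ x y = L (U (L ⟦ x , y ⟧ ∪ ⟦ x ′ ⟧))

-- The two strong modularity laws, specialised to a pair y, y′ whose join is 1 and
-- whose meet is 0, collapse to the two facts that drive the proof:
--   x ∈ LU(y′, M(x,y))            (first law, since U(y′,y) = {1})
--   M(L(a,b), b) ⊆ L(a)           (second law, since L(b′,b) = {0}).
-- The first gives M(x,y) ⊆ L(z) ⇒ x ∈ R(y,z); the second gives divisibility
-- M(R(x,y),x) = L(x,y), from which the converse residuation direction follows by
-- monotonicity of M in its first argument.
module Submission where

open import Defs
open import Level using (Level; _⊔_)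
open import Function using (id)
open import Data.Product using (_×_; proj₁; proj₂) renaming (_,_ to _,,_)
open import Data.Sum using (inj₁; inj₂; [_,_]) renaming (map to ⊎-map; swap to ⊎-swap)
open import Relation.Binary.Bundles using (Poset)
open import Relation.Unary using (Pred; _⊆_; _≐_; _∪_)

module Cones {c ℓ₁ ℓ₂ : Level} (P : Poset c ℓ₁ ℓ₂) where
  open Poset P
  open PosetNotions P

  private
    variable
      ℓ ℓ′ : Level
      A : Pred Carrier ℓ
      B : Pred Carrier ℓ′
      a b w u : Carrier

  L-antitone : A ⊆ B → L B ⊆ L A
  L-antitone A⊆B h y y∈A = h y (A⊆B y∈A)

  U-antitone : A ⊆ B → U B ⊆ U A
  U-antitone A⊆B h y y∈A = h y (A⊆B y∈A)

  L-downward : w ≤ u → L A u → L A w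
  L-downward w≤u h y y∈A = trans w≤u (h y y∈A)

  L-singleton : w ≤ a → L ⟦ a ⟧ w
  L-singleton w≤a y y≈a = trans w≤a (reflexive (Eq.sym y≈a))

  L-pair : w ≤ a → w ≤ b → L ⟦ a , b ⟧ w
  L-pair w≤a w≤b y = [ L-singleton w≤a y , L-singleton w≤b y ]

  U-pair : a ≤ u → b ≤ u → U ⟦ a , b ⟧ u
  U-pair a≤u b≤u y = [ (λ y≈a → trans (reflexive y≈a) a≤u)
                     , (λ y≈b → trans (reflexive y≈b) b≤u) ]

  pair-comm : ⟦ a , b ⟧ ⊆ ⟦ b , a ⟧
  pair-comm = ⊎-swap

  ⊆-LU∪ : A ⊆ L (U (A ∪ B))
  ⊆-LU∪ a∈A u u∈U = u∈U _ (inj₁ a∈A)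

module Multiplication {c ℓ₁ ℓ₂ : Level} (P : Poset c ℓ₁ ℓ₂) (_′ : Poset.Carrier P → Poset.Carrier P) where
  open Poset P
  open PosetNotions P
  open Cones P

  private
    variable
      ℓ ℓ′ : Level
      A : Pred Carrier ℓ
      B : Pred Carrier ℓ′
      a b w : Carrier

  -- MSet _′ at an arbitrary level of A; Mop _′ x y is then definitionally M ⟦ x ⟧ y.
  M : Pred Carrier ℓ → Carrier → Pred Carrier (c ⊔ ℓ ⊔ ℓ₁ ⊔ ℓ₂)
  M A y = L (U (A ∪ ⟦ y ′ ⟧) ∪ ⟦ y ⟧)

  M-monotone : A ⊆ B → M A b ⊆ M B b
  M-monotone A⊆B = L-antitone (⊎-map (U-antitone (⊎-map A⊆B id)) id)

  M⊆L : M A b ⊆ L ⟦ b ⟧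
  M⊆L w∈M y y≈b = w∈M y (inj₂ y≈b)

  M-below : A a → w ≤ a → w ≤ b → M A b w
  M-below a∈A w≤a w≤b y = [ (λ y∈U → trans w≤a (y∈U _ (inj₁ a∈A)))
                          , L-singleton w≤b y ]

  M-closure : M (L (U (A ∪ ⟦ b ′ ⟧))) b ⊆ M A b
  M-closure = L-antitone (⊎-map U⊆ULU id)
    where
    U⊆ULU : U (A ∪ ⟦ b ′ ⟧) ⊆ U (L (U (A ∪ ⟦ b ′ ⟧)) ∪ ⟦ b ′ ⟧)
    U⊆ULU u∈U y = [ (λ y∈L → y∈L _ u∈U) , (λ y≈b′ → u∈U y (inj₂ y≈b′)) ]

module Residuation {c ℓ₁ ℓ₂ : Level} (P : Poset c ℓ₁ ℓ₂)
  (0# 1# : Poset.Carrier P) (_′ : Poset.Carrier P → Poset.Carrier P)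
  (bounded : PosetNotions.IsBounded P 0# 1#)
  (complementation : PosetNotions.IsComplementation P 0# 1# _′)
  (strongly-modular : PosetNotions.IsStronglyModular P) where

  open Poset P
  open PosetNotions P
  open Cones P
  open Multiplication P _′

  private
    variable
      a w : Carrier

  complement-meet : w ≤ a → w ≤ a ′ → w ≈ 0#
  complement-meet w≤a w≤a′ = proj₁ (proj₂ (complementation _)) (L-pair w≤a w≤a′)

  complement-join : a ≤ w → a ′ ≤ w → w ≈ 1#
  complement-join a≤w a′≤w = proj₁ (proj₁ (complementation _)) (U-pair a≤w a′≤w)

  below-0 : w ≈ 0# → w ≤ a
  below-0 w≈0 = trans (reflexive w≈0) (proj₁ bounded _)

  above-1 : w ≈ 1# → a ≤ w
  above-1 w≈1 = trans (proj₂ bounded _) (reflexive (Eq.sym w≈1))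

  x∈LU[y′,M[x,y]] : ∀ x y → L (U (⟦ y ′ ⟧ ∪ M ⟦ x ⟧ y)) x
  x∈LU[y′,M[x,y]] x y =
    L-antitone (U-antitone (⊎-map id L[y,U[y′,x]]⊆M[x,y]))
      (proj₁ (proj₁ strongly-modular (y ′) y x) x∈L[U[y′,y],U[y′,x]])
    where
    x∈L[U[y′,y],U[y′,x]] : L (U ⟦ y ′ , y ⟧ ∪ U ⟦ y ′ , x ⟧) x
    x∈L[U[y′,y],U[y′,x]] u =
      [ (λ u∈U → above-1 (complement-join (u∈U y (inj₂ Eq.refl)) (u∈U (y ′) (inj₁ Eq.refl))))
      , (λ u∈U → u∈U x (inj₂ Eq.refl)) ]
    L[y,U[y′,x]]⊆M[x,y] : L (⟦ y ⟧ ∪ U ⟦ y ′ , x ⟧) ⊆ M ⟦ x ⟧ y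
    L[y,U[y′,x]]⊆M[x,y] = L-antitone (λ s → ⊎-swap (⊎-map (U-antitone pair-comm) id s))

  M[L[a,b],b]⊆L[a] : ∀ a b → M (L ⟦ a , b ⟧) b ⊆ L ⟦ a ⟧
  M[L[a,b],b]⊆L[a] a b w∈M = L-singleton
    (proj₁ (proj₂ strongly-modular a (b ′) b) w∈M a a∈U)
    where
    a∈U : U (L ⟦ a , b ⟧ ∪ L ⟦ b ′ , b ⟧) a
    a∈U y = [ (λ y∈L → y∈L a (inj₁ Eq.refl))
            , (λ y∈L → below-0 (complement-meet (y∈L b (inj₂ Eq.refl)) (y∈L (b ′) (inj₁ Eq.refl)))) ]

  divisible : IsDivisible _′ (Rop _′)
  divisible x y = to ,, from
    where
    to : M (Rop _′ x y) x ⊆ L ⟦ x , y ⟧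
    to w∈M = L-pair (M⊆L w∈M x Eq.refl)
      (M[L[a,b],b]⊆L[a] y x (M-monotone (L-antitone pair-comm) (M-closure w∈M)) y Eq.refl)
    from : L ⟦ x , y ⟧ ⊆ M (Rop _′ x y) x
    from w∈L = M-below (⊆-LU∪ w∈L) refl (w∈L x (inj₁ Eq.refl))

  residuated : ∀ x y z → (M ⟦ x ⟧ y ⊆ L ⟦ z ⟧ → L ⟦ x ⟧ ⊆ Rop _′ y z)
                       × (L ⟦ x ⟧ ⊆ Rop _′ y z → M ⟦ x ⟧ y ⊆ L ⟦ z ⟧)
  residuated x y z = to ,, from
    where
    to : M ⟦ x ⟧ y ⊆ L ⟦ z ⟧ → L ⟦ x ⟧ ⊆ Rop _′ y z
    to M⊆Lz v∈Lx =
      L-downward (v∈Lx x Eq.refl) (L-antitone (U-antitone y′∪M⊆L[y,z]∪y′) (x∈LU[y′,M[x,y]] x y))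
      where
      y′∪M⊆L[y,z]∪y′ : ⟦ y ′ ⟧ ∪ M ⟦ x ⟧ y ⊆ L ⟦ y , z ⟧ ∪ ⟦ y ′ ⟧
      y′∪M⊆L[y,z]∪y′ s =
        ⊎-swap (⊎-map id (λ w∈M → L-pair (M⊆L w∈M y Eq.refl) (M⊆Lz w∈M z Eq.refl)) s)
    from : L ⟦ x ⟧ ⊆ Rop _′ y z → M ⟦ x ⟧ y ⊆ L ⟦ z ⟧
    from Lx⊆R w∈M = L-antitone inj₂
      (proj₁ (divisible y z) (M-monotone (λ t≈x → Lx⊆R (L-singleton (reflexive t≈x))) w∈M))

  M-unit : ∀ x → (M ⟦ x ⟧ 1# ≐ L ⟦ x ⟧) × (M ⟦ 1# ⟧ x ≐ L ⟦ x ⟧)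
  M-unit x = ((λ w∈M → L-singleton (w∈M x (inj₁ (U-pair refl 1′≤x))))
             ,, λ w∈L → M-below Eq.refl (w∈L x Eq.refl) (proj₂ bounded _))
          ,, (M⊆L ,, λ w∈L → M-below Eq.refl (proj₂ bounded _) (w∈L x Eq.refl))
    where
    1′≤x : 1# ′ ≤ x
    1′≤x = below-0 (complement-meet (proj₂ bounded (1# ′)) refl)

  R-zero : ∀ x → Rop _′ x 0# ≐ L ⟦ x ′ ⟧
  R-zero x = (λ w∈R → L-singleton (w∈R (x ′) x′∈U))
          ,, λ w∈L → L-downward (w∈L (x ′) Eq.refl) (λ u u∈U → u∈U (x ′) (inj₂ Eq.refl))
    where
    x′∈U : U (L ⟦ x , 0# ⟧ ∪ ⟦ x ′ ⟧) (x ′)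
    x′∈U t = [ (λ t∈L → trans (t∈L 0# (inj₂ Eq.refl)) (proj₁ bounded _)) , reflexive ]

theorem6 : {c ℓ₁ ℓ₂ : Level} (P : Poset c ℓ₁ ℓ₂) →
    let open Poset P
        open PosetNotions P
    in (0# 1# : Carrier) (_′ : Carrier → Carrier) →
       IsBounded 0# 1# →
       IsComplementation 0# 1# _′ →
       IsStronglyModular →
       IsOperatorLeftResiduated 0# 1# _′ (Mop _′) (Rop _′)
         × IsDivisible _′ (Rop _′)
theorem6 P 0# 1# _′ bounded complementation strongly-modular =
  (bounded ,, M-unit ,, residuated ,, R-zero) ,, divisible
  where
  open Residuation P 0# 1# _′ bounded complementation strongly-modular
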